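{- Let $T$ be a proper binary tree with saturated vertices $u$ and $w$ such that $R_T(u)=R_T(w)$. Let $u_1,w_1$ be the siblings and $u_0,w_0$ the parents of $u,w$ respectively, assume that $u_0$ is an ancestor of $w_0$, and let $w_p$ be the parent of $w_0$. Suppose $R_T(w_1)<R_T(u)=R_T(w)$, that $u_0$ is not the root of $T$, and that $u_0v_1v_2\cdots v_t$ ($t\ge1$) is the path from $u_0$ to the root $v_t$ of $T$. Suppose also $R_T(v_1)>R_T(w_1)$. (1) If it is not the case that $R_T(v_i)>R_T(w_1)$ for all $1\le i\le t$, let $s+1\in\{2,\dots,t\}$ be minimal with $R_T(v_{s+1})\le R_T(w_1)$, and let $T^*=T-w_0w-w_pw_0-v_{s+1}v_s+v_{s+1}w_0+v_sw_0+w_pw$ (rooted at $v_t$). Then $R(T^*)\ge R(T)$. (2) If $R_T(v_i)>R_T(w_1)$ for all $1\le i\le t$, let $T^*=T-w_0w-w_pw_0+w_0v_t+w_pw$ (so that $w_0$, which now has children $w_1$ and $v_t$, is the root of $T^*$). Then $R(T^*)\ge R(T)$.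
   Context: All trees are rooted; $T(v)$ is the subtree induced by $v$ and its descendants; a leaf is a vertex with no children. The rank $R_T(v)$ is the minimum distance from $v$ to a leaf of $T(v)$, and the security is $R(T)=\sum_{v}R_T(v)$. A proper binary tree is an unordered rooted tree in which every non-leaf vertex has exactly two children. A complete binary tree is a proper binary tree whose leaves are all at the same distance from its root. A vertex $v$ of a proper binary tree $T$ is saturated if $T(v)$ is a complete binary tree but $T(x)$ is not a complete binary tree for any proper ancestor $x$ of $v$. -}

module Defs where

open import Data.Nat using (ℕ; zero; suc; _+_; _⊓_)
open import Data.List using (List; []; _∷_; _++_; length)
open import Data.Product using (Σ; ∃; _×_)
open import Relation.Binary.PropositionalEquality using (_≡_; _≢_)
open import Relation.Nullary using (¬_)

-- Proper binary trees: every vertex is a leaf or has exactly two children.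
-- (The order of the two children carries no meaning; all notions below are
-- invariant under swapping children.)
data Tree : Set where
  leaf : Tree
  node : Tree → Tree → Tree

-- Vertices of a tree are named by their path from the root.
data Dir : Set where
  left right : Dir

other : Dir → Dir
other left  = right
other right = left

Pos : Set
Pos = List Dir

data Valid : Tree → Pos → Set where
  here  : ∀ {t} → Valid t []
  goL   : ∀ {l r p} → Valid l p → Valid (node l r) (left ∷ p)
  goR   : ∀ {l r p} → Valid r p → Valid (node l r) (right ∷ p)

-- the subtree T(v) induced by v and its descendants (junk value leaf if invalid)
sub : Tree → Pos → Tree
sub t []                       = t
sub leaf (_ ∷ _)               = leaf
sub (node l r) (left ∷ p)      = sub l p
sub (node l r) (right ∷ p)     = sub r p

-- replace the subtree rooted at position p by s (no-op beyond invalid positions)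
graft : Tree → Pos → Tree → Tree
graft t [] s                   = s
graft leaf (_ ∷ _) s           = leaf
graft (node l r) (left ∷ p) s  = node (graft l p s) r
graft (node l r) (right ∷ p) s = node l (graft r p s)

child : Pos → Dir → Pos
child p d = p ++ (d ∷ [])

-- x is an ancestor of v (x = v allowed)
_≼_ : Pos → Pos → Set
x ≼ v = ∃ λ q → x ++ q ≡ v

_≺_ : Pos → Pos → Set
x ≺ v = ∃ λ q → q ≢ [] × x ++ q ≡ v

rank : Tree → ℕ
rank leaf       = 0
rank (node l r) = suc (rank l ⊓ rank r)

rankAt : Tree → Pos → ℕ
rankAt t p = rank (sub t p)

security : Tree → ℕ
security leaf       = 0
security (node l r) = rank (node l r) + security l + security r

Complete : Tree → Set
Complete t = ∃ λ h → ∀ p → Valid t p → sub t p ≡ leaf → length p ≡ h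

Saturated : Tree → Pos → Set
Saturated t v = Valid t v × Complete (sub t v) × (∀ x → x ≺ v → ¬ Complete (sub t x))

{-# OPTIONS --safe #-}
module Submission where

-- Let r = R(w1) < R(w).  As R(w0) = r + 1 ≤ R(w), letting w take the place of w0 lowers no rank, and
-- loses at most the vertex w0 (of rank r + 1) together with T(w1).  Reattaching T(w1) next to a subtree
-- of rank > r creates a vertex of rank exactly r + 1 and repays this.  In case (2) that vertex is the new
-- root.  In case (1) it becomes a child of v_{s+1}, whose other child has rank < r because
-- R(v_{s+1}) ≤ r < R(v_s); so R(v_{s+1}), and with it every rank further up, is unchanged.

open import Defs
open import Data.Nat using (ℕ; suc; _+_; _∸_; _≤_; _<_; _>_; _≥_; _⊓_; s≤s; z≤n)
open import Data.Nat.Properties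
open import Data.Nat.Tactic.RingSolver using (solve-∀)
open import Data.List using ([]; _∷_; _++_; length; take; drop; lookup)
open import Data.List.Properties using (++-assoc; take++drop≡id; take-suc)
open import Data.Fin using (fromℕ<)
open import Data.Fin.Properties using (toℕ-fromℕ<)
open import Data.Product using (∃; _×_; _,_; proj₁; proj₂)
open import Data.Sum using (inj₁; inj₂)
open import Data.Empty using (⊥-elim)
open import Relation.Binary.PropositionalEquality
  using (_≡_; _≢_; refl; sym; trans; cong; subst; subst₂; module ≡-Reasoning)

sub-leaf : ∀ p → sub leaf p ≡ leaf
sub-leaf []      = refl
sub-leaf (_ ∷ _) = refl

sub-++ : ∀ t p q → sub t (p ++ q) ≡ sub (sub t p) q
sub-++ t          []           q = refl
sub-++ leaf       (_ ∷ p)      q = sym (sub-leaf q)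
sub-++ (node l r) (left  ∷ p)  q = sub-++ l p q
sub-++ (node l r) (right ∷ p)  q = sub-++ r p q

graft-++ : ∀ t p q s → graft t (p ++ q) s ≡ graft t p (graft (sub t p) q s)
graft-++ t          []          q s = refl
graft-++ leaf       (_ ∷ p)     q s = refl
graft-++ (node l r) (left  ∷ p) q s = cong (λ l′ → node l′ r) (graft-++ l p q s)
graft-++ (node l r) (right ∷ p) q s = cong (node l) (graft-++ r p q s)

graft-graft : ∀ t p a b → graft (graft t p a) p b ≡ graft t p b
graft-graft t          []          a b = refl
graft-graft leaf       (_ ∷ p)     a b = refl
graft-graft (node l r) (left  ∷ p) a b = cong (λ l′ → node l′ r) (graft-graft l p a b)
graft-graft (node l r) (right ∷ p) a b = cong (node l) (graft-graft r p a b)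

sub-graft : ∀ {t p} → Valid t p → ∀ s → sub (graft t p s) p ≡ s
sub-graft here    s = refl
sub-graft (goL v) s = sub-graft v s
sub-graft (goR v) s = sub-graft v s

Valid-++⁻ˡ : ∀ {t} p {q} → Valid t (p ++ q) → Valid t p
Valid-++⁻ˡ []          v       = here
Valid-++⁻ˡ (left  ∷ p) (goL v) = goL (Valid-++⁻ˡ p v)
Valid-++⁻ˡ (right ∷ p) (goR v) = goR (Valid-++⁻ˡ p v)

Valid-sub-++ : ∀ {t} p {q} → Valid t (p ++ q) → Valid (sub t p) q
Valid-sub-++ []          v       = v
Valid-sub-++ (left  ∷ p) (goL v) = Valid-sub-++ p v
Valid-sub-++ (right ∷ p) (goR v) = Valid-sub-++ p v

≼-trans : ∀ {x y z} → x ≼ y → y ≼ z → x ≼ z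
≼-trans {x} (q , refl) (q′ , refl) = q ++ q′ , sym (++-assoc x q q′)

take-≼ : ∀ k (xs : Pos) → take k xs ≼ xs
take-≼ k xs = drop k xs , take++drop≡id k xs

≢[]⇒length>0 : ∀ {xs : Pos} → xs ≢ [] → 0 < length xs
≢[]⇒length>0 {[]}    xs≢[] = ⊥-elim (xs≢[] refl)
≢[]⇒length>0 {_ ∷ _} _     = s≤s z≤n

take-∸-child : ∀ (xs : Pos) s → s < length xs →
  ∃ λ d → child (take (length xs ∸ suc s) xs) d ≡ take (length xs ∸ s) xs
take-∸-child xs s s<n = lookup xs (fromℕ< k<n) , (begin
  child (take k xs) (lookup xs (fromℕ< k<n)) ≡⟨ take-suc-child ⟨
  take (suc k) xs                            ≡⟨ cong (λ j → take j xs) n∸s≡1+k ⟨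
  take (length xs ∸ s) xs                    ∎)
  where
  open ≡-Reasoning
  k : ℕ
  k = length xs ∸ suc s
  n∸s≡1+k : length xs ∸ s ≡ suc k
  n∸s≡1+k = +-∸-assoc 1 s<n
  k<n : k < length xs
  k<n = subst (_≤ length xs) n∸s≡1+k (m∸n≤m (length xs) s)
  take-suc-child : take (suc k) xs ≡ child (take k xs) (lookup xs (fromℕ< k<n))
  take-suc-child = subst (λ j → take (suc j) xs ≡ child (take j xs) (lookup xs (fromℕ< k<n)))
                         (toℕ-fromℕ< k<n) (take-suc xs (fromℕ< k<n))

nodeWith : Dir → Tree → Tree → Tree
nodeWith left  a b = node a b
nodeWith right a b = node b a

rank-nodeWith : ∀ d a b → rank (nodeWith d a b) ≡ suc (rank a ⊓ rank b)
rank-nodeWith left  a b = refl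
rank-nodeWith right a b = cong suc (⊓-comm (rank b) (rank a))

security-nodeWith : ∀ d a b →
  security (nodeWith d a b) ≡ suc (rank a ⊓ rank b) + security a + security b
security-nodeWith left  a b = refl
security-nodeWith right a b =
  trans (cong (λ k → k + security b + security a) (rank-nodeWith right a b)) (swap _ (security b) (security a))
  where
  swap : ∀ k m n → k + m + n ≡ k + n + m
  swap = solve-∀

graft-nodeWith : ∀ d a b s → graft (nodeWith d a b) (d ∷ []) s ≡ nodeWith d s b
graft-nodeWith left  a b s = refl
graft-nodeWith right a b s = refl

nodeWith-children : ∀ {t d} → Valid t (d ∷ []) → t ≡ nodeWith d (sub t (d ∷ [])) (sub t (other d ∷ []))
nodeWith-children (goL here) = refl
nodeWith-children (goR here) = refl

sub≡nodeWith : ∀ {t} p {d} → Valid t (child p d) →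
  sub t p ≡ nodeWith d (sub t (child p d)) (sub t (child p (other d)))
sub≡nodeWith {t} p {d} v rewrite sub-++ t p (d ∷ []) | sub-++ t p (other d ∷ []) =
  nodeWith-children (Valid-sub-++ p v)

rank-graft-mono : ∀ t p s → rank (sub t p) ≤ rank s → rank t ≤ rank (graft t p s)
rank-graft-mono t          []          s h = h
rank-graft-mono leaf       (_ ∷ p)     s h = ≤-refl
rank-graft-mono (node l r) (left  ∷ p) s h = s≤s (⊓-monoˡ-≤ (rank r) (rank-graft-mono l p s h))
rank-graft-mono (node l r) (right ∷ p) s h = s≤s (⊓-monoʳ-≤ (rank l) (rank-graft-mono r p s h))

security-nodeWith-mono : ∀ d {a a′} b x y → rank a ≤ rank a′ → security a + x ≤ security a′ + y →
  security (nodeWith d a b) + x ≤ security (nodeWith d a′ b) + y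
security-nodeWith-mono d {a} {a′} b x y ra≤ra′ sa+x≤sa′+y = begin
  security (nodeWith d a b) + x                    ≡⟨ cong (_+ x) (security-nodeWith d a b) ⟩
  suc (rank a ⊓ rank b) + security a + security b + x   ≡⟨ shuffle _ (security a) (security b) x ⟩
  (suc (rank a ⊓ rank b) + security b) + (security a + x)
    ≤⟨ +-mono-≤ (+-monoˡ-≤ (security b) (s≤s (⊓-monoˡ-≤ (rank b) ra≤ra′))) sa+x≤sa′+y ⟩
  (suc (rank a′ ⊓ rank b) + security b) + (security a′ + y) ≡⟨ shuffle _ (security a′) (security b) y ⟨
  suc (rank a′ ⊓ rank b) + security a′ + security b + y ≡⟨ cong (_+ y) (security-nodeWith d a′ b) ⟨
  security (nodeWith d a′ b) + y                   ∎
  where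
  open ≤-Reasoning
  shuffle : ∀ k m n o → k + m + n + o ≡ (k + n) + (m + o)
  shuffle = solve-∀

security-graft : ∀ {t p} → Valid t p → ∀ s → rank (sub t p) ≤ rank s →
  security t + security s ≤ security (graft t p s) + security (sub t p)
security-graft {t} here s _ = ≤-reflexive (+-comm (security t) (security s))
security-graft {node l r} {left ∷ p} (goL v) s h =
  security-nodeWith-mono left r (security s) (security (sub l p)) (rank-graft-mono l p s h) (security-graft v s h)
security-graft {node l r} {right ∷ p} (goR v) s h =
  security-nodeWith-mono right l (security s) (security (sub r p)) (rank-graft-mono r p s h) (security-graft v s h)

security-graft-mono : ∀ {t p s} → Valid t p → rank (sub t p) ≤ rank s → security (sub t p) ≤ security s →
  security t ≤ security (graft t p s)
security-graft-mono {t} {p} {s} v r≤ s≤ =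
  +-cancelʳ-≤ (security (sub t p)) (security t) (security (graft t p s))
    (≤-trans (+-monoʳ-≤ (security t) s≤) (security-graft v s r≤))

-- T − w0w − wpw0 + wpw in the paper's notation, for p = w0 and w = child p d.
hoist : Tree → Pos → Dir → Tree
hoist t p d = graft t p (sub t (child p d))

module _ {t : Tree} {p : Pos} {d : Dir} (v : Valid t (child p d))
         (smaller : rank (sub t (child p (other d))) < rank (sub t (child p d))) where

  private
    Tw W1 : Tree
    Tw = sub t (child p d)
    W1 = sub t (child p (other d))

    rank-parent : rank (sub t p) ≡ suc (rank W1)
    rank-parent = trans (cong rank (sub≡nodeWith p v))
                        (trans (rank-nodeWith d Tw W1) (cong suc (m≥n⇒m⊓n≡n (<⇒≤ smaller))))

    rank-parent≤ : rank (sub t p) ≤ rank Tw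
    rank-parent≤ = subst (_≤ rank Tw) (sym rank-parent) smaller

  rank-hoist : rank t ≤ rank (hoist t p d)
  rank-hoist = rank-graft-mono t p Tw rank-parent≤

  security-hoist : security t ≤ suc (rank W1) + security (hoist t p d) + security W1
  security-hoist = +-cancelʳ-≤ (security Tw) (security t) _ (begin
    security t + security Tw                     ≤⟨ security-graft (Valid-++⁻ˡ p v) Tw rank-parent≤ ⟩
    security (hoist t p d) + security (sub t p)  ≡⟨ cong (λ x → security (hoist t p d) + security x) (sub≡nodeWith p v) ⟩
    security (hoist t p d) + security (nodeWith d Tw W1)
      ≡⟨ cong (security (hoist t p d) +_) (security-nodeWith d Tw W1) ⟩
    security (hoist t p d) + (suc (rank Tw ⊓ rank W1) + security Tw + security W1)
      ≡⟨ cong (λ k → security (hoist t p d) + (suc k + security Tw + security W1)) (m≥n⇒m⊓n≡n (<⇒≤ smaller)) ⟩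
    security (hoist t p d) + (suc (rank W1) + security Tw + security W1)
      ≡⟨ rearrange (security (hoist t p d)) (suc (rank W1)) (security Tw) (security W1) ⟩
    suc (rank W1) + security (hoist t p d) + security W1 + security Tw ∎)
    where
    open ≤-Reasoning
    rearrange : ∀ h k m n → h + (k + m + n) ≡ k + h + n + m
    rearrange = solve-∀

  hoist-reattach : ∀ e → rank W1 < rank t →
    rank (nodeWith e (hoist t p d) W1) ≡ suc (rank W1) ×
    security t ≤ security (nodeWith e (hoist t p d) W1)
  hoist-reattach e w1<t = rank-reattached , (begin
    security t                                                 ≤⟨ security-hoist ⟩
    suc (rank W1) + security (hoist t p d) + security W1
      ≡⟨ cong (λ k → suc k + security (hoist t p d) + security W1) (sym min-is-W1) ⟩
    suc (rank (hoist t p d) ⊓ rank W1) + security (hoist t p d) + security W1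
      ≡⟨ security-nodeWith e (hoist t p d) W1 ⟨
    security (nodeWith e (hoist t p d) W1) ∎)
    where
    open ≤-Reasoning
    min-is-W1 : rank (hoist t p d) ⊓ rank W1 ≡ rank W1
    min-is-W1 = m≥n⇒m⊓n≡n (<⇒≤ (<-≤-trans w1<t rank-hoist))
    rank-reattached : rank (nodeWith e (hoist t p d) W1) ≡ suc (rank W1)
    rank-reattached = trans (rank-nodeWith e (hoist t p d) W1) (cong suc min-is-W1)

sub-child-++ : ∀ t p m d → sub t (child (p ++ m) d) ≡ sub (sub t p) (child m d)
sub-child-++ t p m d = trans (cong (sub t) (++-assoc p m (d ∷ []))) (sub-++ t p (child m d))

hoist-++ : ∀ t p m d → hoist t (p ++ m) d ≡ graft t p (hoist (sub t p) m d)
hoist-++ t p m d = trans (graft-++ t p m _) (cong (λ s → graft t p (graft (sub t p) m s)) (sub-child-++ t p m d))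

m⊓n<o<m⇒n<o : ∀ {m n o} → m ⊓ n < o → o < m → n < o
m⊓n<o<m⇒n<o {m} {n} m⊓n<o o<m with ⊓-sel m n
... | inj₁ m⊓n≡m = ⊥-elim (<-asym (subst (_< _) m⊓n≡m m⊓n<o) o<m)
... | inj₂ m⊓n≡n = subst (_< _) m⊓n≡n m⊓n<o

nodeWith-replace-dominant : ∀ d {a a′ b} → rank b ≤ rank a → rank b ≤ rank a′ → security a ≤ security a′ →
  rank (nodeWith d a b) ≡ rank (nodeWith d a′ b) × security (nodeWith d a b) ≤ security (nodeWith d a′ b)
nodeWith-replace-dominant d {a} {a′} {b} b≤a b≤a′ sa≤sa′ =
  trans (rank-nodeWith d a b) (trans (cong suc same-min) (sym (rank-nodeWith d a′ b))) ,
  subst₂ _≤_ (sym (security-nodeWith d a b)) (sym (security-nodeWith d a′ b))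
    (+-monoˡ-≤ (security b) (+-mono-≤ (≤-reflexive (cong suc same-min)) sa≤sa′))
  where
  same-min : rank a ⊓ rank b ≡ rank a′ ⊓ rank b
  same-min = trans (m≥n⇒m⊓n≡n b≤a) (sym (m≥n⇒m⊓n≡n b≤a′))

security-hoist-reattach-at : ∀ {t q p w0} d dw → child q d ≡ p → p ≼ w0 → Valid t (child w0 dw) →
  rank (sub t (child w0 (other dw))) < rank (sub t (child w0 dw)) →
  rank (sub t (child w0 (other dw))) < rank (sub t p) →
  rank (sub t q) ≤ rank (sub t (child w0 (other dw))) →
  security t ≤ security (graft (hoist t w0 dw) p (node (sub (hoist t w0 dw) p) (sub t (child w0 (other dw)))))
security-hoist-reattach-at {t} {q} d dw refl (m , refl) v w1<w w1<A q≤w1 =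
  subst (λ x → security t ≤ security x) (sym surgery) (security-graft-mono vq rank≤ security≤)
  where
  open ≡-Reasoning
  p : Pos
  p = child q d
  A B W1 A′ : Tree
  A  = sub t p
  B  = sub t (child q (other d))
  W1 = sub t (child (p ++ m) (other dw))
  A′ = hoist A m dw

  v′ : Valid t (p ++ child m dw)
  v′ = subst (Valid t) (++-assoc p m (dw ∷ [])) v
  vp : Valid t p
  vp = Valid-++⁻ˡ p v′
  vq : Valid t q
  vq = Valid-++⁻ˡ q vp

  sub-q : sub t q ≡ nodeWith d A B
  sub-q = sub≡nodeWith q vp

  reattached : rank (node A′ W1) ≡ suc (rank W1) × security A ≤ security (node A′ W1)
  reattached =
    subst (λ W → rank (node A′ W) ≡ suc (rank W) × security A ≤ security (node A′ W))
      (sym (sub-child-++ t p m (other dw)))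
      (hoist-reattach (Valid-sub-++ p v′)
        (subst₂ (λ x y → rank x < rank y) (sub-child-++ t p m (other dw)) (sub-child-++ t p m dw) w1<w)
        left (subst (λ x → rank x < rank A) (sub-child-++ t p m (other dw)) w1<A))

  B<W1 : rank B < rank W1
  B<W1 = m⊓n<o<m⇒n<o (subst (_≤ rank W1) (trans (cong rank sub-q) (rank-nodeWith d A B)) q≤w1) w1<A

  replaced : rank (nodeWith d A B) ≡ rank (nodeWith d (node A′ W1) B) ×
             security (nodeWith d A B) ≤ security (nodeWith d (node A′ W1) B)
  replaced = nodeWith-replace-dominant d (<⇒≤ (<-trans B<W1 w1<A))
    (subst (rank B ≤_) (sym (proj₁ reattached)) (≤-trans (<⇒≤ B<W1) (n≤1+n (rank W1))))
    (proj₂ reattached)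

  rank≤ : rank (sub t q) ≤ rank (nodeWith d (node A′ W1) B)
  rank≤ = ≤-reflexive (trans (cong rank sub-q) (proj₁ replaced))

  security≤ : security (sub t q) ≤ security (nodeWith d (node A′ W1) B)
  security≤ = subst (λ x → security x ≤ security (nodeWith d (node A′ W1) B)) (sym sub-q) (proj₂ replaced)

  surgery : graft (hoist t (p ++ m) dw) p (node (sub (hoist t (p ++ m) dw) p) W1)
          ≡ graft t q (nodeWith d (node A′ W1) B)
  surgery = begin
    graft (hoist t (p ++ m) dw) p (node (sub (hoist t (p ++ m) dw) p) W1)
      ≡⟨ cong (λ x → graft x p (node (sub x p) W1)) (hoist-++ t p m dw) ⟩
    graft (graft t p A′) p (node (sub (graft t p A′) p) W1)
      ≡⟨ cong (λ x → graft (graft t p A′) p (node x W1)) (sub-graft vp A′) ⟩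
    graft (graft t p A′) p (node A′ W1)      ≡⟨ graft-graft t p A′ (node A′ W1) ⟩
    graft t p (node A′ W1)                   ≡⟨ graft-++ t q (d ∷ []) (node A′ W1) ⟩
    graft t q (graft (sub t q) (d ∷ []) (node A′ W1))
      ≡⟨ cong (λ x → graft t q (graft x (d ∷ []) (node A′ W1))) sub-q ⟩
    graft t q (graft (nodeWith d A B) (d ∷ []) (node A′ W1))
      ≡⟨ cong (graft t q) (graft-nodeWith d A B (node A′ W1)) ⟩
    graft t q (nodeWith d (node A′ W1) B) ∎

lemma2p7 : (T : Tree) (u0 w0 : Pos) (du dw : Dir) →
  child u0 du ≢ child w0 dw →
  Saturated T (child u0 du) → Saturated T (child w0 dw) →
  rankAt T (child u0 du) ≡ rankAt T (child w0 dw) →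
  u0 ≼ w0 →
  rankAt T (child w0 (other dw)) < rankAt T (child u0 du) →
  u0 ≢ [] →
  rankAt T (take (length u0 ∸ 1) u0) > rankAt T (child w0 (other dw)) →
  ((s : ℕ) → 1 ≤ s → s < length u0 →
    (∀ i → 1 ≤ i → i ≤ s → rankAt T (take (length u0 ∸ i) u0) > rankAt T (child w0 (other dw))) →
    rankAt T (take (length u0 ∸ suc s) u0) ≤ rankAt T (child w0 (other dw)) →
    security (graft (graft T w0 (sub T (child w0 dw)))
                    (take (length u0 ∸ s) u0)
                    (node (sub (graft T w0 (sub T (child w0 dw))) (take (length u0 ∸ s) u0))
                          (sub T (child w0 (other dw)))))
      ≥ security T)
  ×
  ((∀ i → 1 ≤ i → i ≤ length u0 → rankAt T (take (length u0 ∸ i) u0) > rankAt T (child w0 (other dw))) →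
    security (node (sub T (child w0 (other dw))) (graft T w0 (sub T (child w0 dw)))) ≥ security T)
lemma2p7 T u0 w0 du dw _ _ (valid-w , _) u≡w u0≼w0 w1<u u0≢[] _ =
  (λ s 1≤s s<n above below →
     let (d , parent) = take-∸-child u0 s s<n in
     security-hoist-reattach-at d dw parent (≼-trans (take-≼ (n ∸ s) u0) u0≼w0) valid-w w1<w
       (above s 1≤s ≤-refl) below) ,
  (λ above →
     let w1<T = subst (λ j → rankAt T (child w0 (other dw)) < rankAt T (take j u0)) (n∸n≡0 n)
                      (above n (≢[]⇒length>0 u0≢[]) ≤-refl) in
     proj₂ (hoist-reattach valid-w w1<w right w1<T))
  where
  n : ℕ
  n = length u0
  w1<w : rankAt T (child w0 (other dw)) < rankAt T (child w0 dw)
  w1<w = subst (rankAt T (child w0 (other dw)) <_) u≡w w1<u
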